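{- Let $\Gamma$ be a framed graph, $\Delta$ a maximal clique of routes, and $\bar s$ a brick with left corner $c$. The following are equivalent: (1) $\bar s$ is left-clockwise to $\Delta$; (2) $\bar s$ is strictly larger than the left-cornered route $\bar s_c(\Delta)$ in the outgoing order at $c^\bullet$; (3) $\bar s$ is left-clockwise to the upper cornering route $r^\uparrow_c(\Delta)$.
   Context: A flow graph $G$ is a finite directed acyclic graph with vertex set $[n]$ and a finite multiset of edges, each directed from a smaller to a larger vertex. Sources (resp. sinks) have no incoming (resp. outgoing) edge; other vertices are internal. A route is a directed path from a source to a sink. A framing assigns to every internal vertex $v$ total orders $<_{\mathrm{in}(v)}$ on incoming edges and $<_{\mathrm{out}(v)}$ on outgoing edges of $v$; $\Gamma=(G,F)$ is a framed graph. A left corner is $c=(c^\bullet,c^\downarrow,c^\uparrow)$ with $c^\bullet$ internal and $c^\downarrow<_{\mathrm{in}(c^\bullet)}c^\uparrow$ consecutive incoming edges of $c^\bullet$; a right corner is the same with consecutive outgoing edges. A generalized path is $\bar s=L(\bar s)\,s\,R(\bar s)$ where $s$ is a directed path (possibly of length $0$) from $v$ to $v'$, $L(\bar s)$ is either $v$ or a left corner with $L(\bar s)^\bullet=v$, and $R(\bar s)$ is either $v'$ or a right corner with $R(\bar s)^\bullet=v'$; it passes through the vertices of $s$. A brick has both $L$ and $R$ corners; a left-cornered route has $L$ a left corner and $R$ a sink. At each internal vertex $v$, extend $<_{\mathrm{in}(v)}$ to a total order on incoming edges and left corners at $v$ by $c^\downarrow<c<c^\uparrow$, and $<_{\mathrm{out}(v)}$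 similarly with right corners. For generalized paths through $v$, the outgoing preorder $\le^+_v$ compares the parts after $v$ lexicographically (letters compared by the extended orders $<_{\mathrm{out}}$) and the incoming preorder $\le^-_v$ compares the parts before $v$ read backwards lexicographically (letters compared by the extended orders $<_{\mathrm{in}}$). Routes $p,q$ are coherent if neither is clockwise to the other, i.e. there is no shared internal vertex $v$ with $p<^-_vq$ and $p>^+_vq$. A maximal clique is an inclusion-maximal set of pairwise coherent routes. In a maximal clique $\Delta$, routes through $v$ are totally ordered by $p\preceq q$ iff $p\le^-_vq$ and $p\le^+_vq$; the upper cornering route $r^\uparrow_c(\Delta)$ is the $\preceq$-smallest route of $\Delta$ using $c^\uparrow$ and the lower cornering route $r^\downarrow_c(\Delta)$ is the $\preceq$-largest route of $\Delta$ using $c^\downarrow$ (at $v=c^\bullet$); they coincide after $c^\bullet$, and $\bar s_c(\Delta)$ is the left-cornered route consisting of $c$ followed by this common part. A brick $\bar s$ is left-clockwise to a route $p$ if, with $v=L(\bar s)^\bullet$, $p$ passes through $v$ and $\bar s<^-_vp$ and $\bar s>^+_vp$; it is left-clockwise to $\Delta$ if it is left-clockwise to some route of $\Delta$. -}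

module Defs where

open import Data.Nat using (ℕ)
open import Data.Fin using (Fin) renaming (_<_ to _<ᶠ_)
open import Data.Fin.Properties using (_≟_)
open import Data.List using (List; []; _∷_; _++_; map; reverse; [_])
open import Data.List.Membership.Propositional using (_∈_)
open import Data.List.Relation.Unary.Unique.Propositional using (Unique)
open import Data.Product using (Σ; ∃; ∃₂; _×_; _,_)
open import Data.Sum using (_⊎_)
open import Data.Unit using (⊤)
open import Relation.Nullary using (¬_; yes; no)
open import Relation.Binary.PropositionalEquality using (_≡_)
open import Relation.Unary using (Pred; _⊆_)

-- A flow graph: vertex set [n] (as Fin n), a finite multiset of m edges
-- (indexed by Fin m), each directed from a smaller to a larger vertex.
record FlowGraph : Set where
  field
    n m : ℕ
    src tgt : Fin m → Fin n
    src<tgt : ∀ e → src e <ᶠ tgt e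

module Graph (G : FlowGraph) where
  open FlowGraph G public
  V E : Set
  V = Fin n
  E = Fin m

  IsSource IsSink Internal : V → Set
  IsSource v = ∀ e → ¬ (tgt e ≡ v)
  IsSink v = ∀ e → ¬ (src e ≡ v)
  Internal v = (∃ λ e → tgt e ≡ v) × (∃ λ e → src e ≡ v)

-- A framing: for every internal vertex a total order on its incoming and
-- on its outgoing edges, given as a duplicate-free list listing exactly
-- those edges from smallest to largest.
record Framing (G : FlowGraph) : Set where
  open Graph G
  field
    inOrd outOrd : V → List E
    inOrd-ok : ∀ v → Internal v →
      Unique (inOrd v) × (∀ e → (e ∈ inOrd v → tgt e ≡ v) × (tgt e ≡ v → e ∈ inOrd v))
    outOrd-ok : ∀ v → Internal v →
      Unique (outOrd v) × (∀ e → (e ∈ outOrd v → src e ≡ v) × (src e ≡ v → e ∈ outOrd v))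

Before : ∀ {A : Set} → A → A → List A → Set
Before x y L = ∃ λ xs → ∃₂ λ ys zs → L ≡ xs ++ x ∷ ys ++ y ∷ zs

module Framed (G : FlowGraph) (F : Framing G) where
  open Graph G public
  open Framing F public

  -- Left end of a generalized path: the starting vertex, or a left corner
  -- (c↓ , c↑) at the starting vertex.  Similarly for the right end.
  data LEnd : Set where
    lVert : LEnd
    lCorner : E → E → LEnd

  data REnd : Set where
    rVert : REnd
    rCorner : E → E → REnd

  -- generalized path  L s R  with s the path starting at 'start' with edges 'edges'
  record GPath : Set where
    constructor gpath
    field
      start : V
      edges : List E
      lend : LEnd
      rend : REnd
  open GPath public

  IsPath : V → List E → Set
  IsPath w [] = ⊤
  IsPath w (e ∷ es) = (src e ≡ w) × IsPath (tgt e) es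

  endV : V → List E → V
  endV w [] = w
  endV w (e ∷ es) = endV (tgt e) es

  LeftCorner : V → E → E → Set
  LeftCorner v a b = Internal v × ∃₂ λ xs ys → inOrd v ≡ xs ++ a ∷ b ∷ ys

  RightCorner : V → E → E → Set
  RightCorner v a b = Internal v × ∃₂ λ xs ys → outOrd v ≡ xs ++ a ∷ b ∷ ys

  LOk : V → LEnd → Set
  LOk v lVert = ⊤
  LOk v (lCorner a b) = LeftCorner v a b

  ROk : V → REnd → Set
  ROk v rVert = ⊤
  ROk v (rCorner a b) = RightCorner v a b

  IsGPath : GPath → Set
  IsGPath p = IsPath (start p) (edges p) × LOk (start p) (lend p)
              × ROk (endV (start p) (edges p)) (rend p)

  IsLCorner : LEnd → Set
  IsLCorner lVert = Data.Empty.⊥ where import Data.Empty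
  IsLCorner (lCorner _ _) = ⊤

  IsRCorner : REnd → Set
  IsRCorner rVert = Data.Empty.⊥ where import Data.Empty
  IsRCorner (rCorner _ _) = ⊤

  IsBrick : GPath → Set
  IsBrick p = IsGPath p × IsLCorner (lend p) × IsRCorner (rend p)

  IsRoute : GPath → Set
  IsRoute p = IsGPath p × lend p ≡ lVert × rend p ≡ rVert
              × IsSource (start p) × IsSink (endV (start p) (edges p))

  -- letters of the words read after / before a vertex
  data OutLetter : Set where
    oEdge : E → OutLetter
    oCorner : E → E → OutLetter
    oEnd : OutLetter

  data InLetter : Set where
    iEdge : E → InLetter
    iCorner : E → E → InLetter
    iEnd : InLetter

  rLetter : REnd → OutLetter
  rLetter rVert = oEnd
  rLetter (rCorner a b) = oCorner a b

  lLetter : LEnd → InLetter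
  lLetter lVert = iEnd
  lLetter (lCorner a b) = iCorner a b

  extOut : List E → List OutLetter
  extOut [] = []
  extOut (e ∷ []) = oEdge e ∷ []
  extOut (e ∷ f ∷ es) = oEdge e ∷ oCorner e f ∷ extOut (f ∷ es)

  extIn : List E → List InLetter
  extIn [] = []
  extIn (e ∷ []) = iEdge e ∷ []
  extIn (e ∷ f ∷ es) = iEdge e ∷ iCorner e f ∷ extIn (f ∷ es)

  _<out[_]_ : OutLetter → V → OutLetter → Set
  x <out[ v ] y = Before x y (extOut (outOrd v))

  _<in[_]_ : InLetter → V → InLetter → Set
  x <in[ v ] y = Before x y (extIn (inOrd v))

  data LexOut : V → List OutLetter → List OutLetter → Set where
    here : ∀ {v x y xs ys} → x <out[ v ] y → LexOut v (x ∷ xs) (y ∷ ys)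
    there : ∀ {v e xs ys} → LexOut (tgt e) xs ys → LexOut v (oEdge e ∷ xs) (oEdge e ∷ ys)

  data LexIn : V → List InLetter → List InLetter → Set where
    here : ∀ {v x y xs ys} → x <in[ v ] y → LexIn v (x ∷ xs) (y ∷ ys)
    there : ∀ {v e xs ys} → LexIn (src e) xs ys → LexIn v (iEdge e ∷ xs) (iEdge e ∷ ys)

  -- p passes through v: splitting of its edges at v
  record Split (p : GPath) (v : V) : Set where
    constructor split
    field
      pre post : List E
      eq : edges p ≡ pre ++ post
      at : endV (start p) pre ≡ v

  afterW : ∀ {p v} → Split p v → List OutLetter
  afterW {p} (split _ post _ _) = map oEdge post ++ [ rLetter (rend p) ]

  beforeW : ∀ {p v} → Split p v → List InLetter
  beforeW {p} (split pre _ _ _) = reverse (map iEdge pre) ++ [ lLetter (lend p) ]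

  OutLt OutEq OutLe InLt InEq InLe : V → GPath → GPath → Set
  OutLt v p q = Σ (Split p v) λ sp → Σ (Split q v) λ sq → LexOut v (afterW sp) (afterW sq)
  OutEq v p q = Σ (Split p v) λ sp → Σ (Split q v) λ sq → afterW sp ≡ afterW sq
  OutLe v p q = OutLt v p q ⊎ OutEq v p q
  InLt v p q = Σ (Split p v) λ sp → Σ (Split q v) λ sq → LexIn v (beforeW sp) (beforeW sq)
  InEq v p q = Σ (Split p v) λ sp → Σ (Split q v) λ sq → beforeW sp ≡ beforeW sq
  InLe v p q = InLt v p q ⊎ InEq v p q

  Clockwise : GPath → GPath → Set
  Clockwise p q = ∃ λ v → Internal v × InLt v p q × OutLt v q p

  Coherent : GPath → GPath → Set
  Coherent p q = ¬ Clockwise p q × ¬ Clockwise q p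

  IsClique : Pred GPath _ → Set
  IsClique Δ = (∀ p → Δ p → IsRoute p) × (∀ p q → Δ p → Δ q → Coherent p q)

  IsMaxClique : Pred GPath _ → Set₁
  IsMaxClique Δ = IsClique Δ × (∀ (Δ' : Pred GPath _) → IsClique Δ' → Δ ⊆ Δ' → Δ' ⊆ Δ)

  Preceq : V → GPath → GPath → Set
  Preceq v p q = InLe v p q × OutLe v p q

  IsUpperCornering : Pred GPath _ → V → E → E → GPath → Set
  IsUpperCornering Δ v a b r =
    Δ r × b ∈ edges r × (∀ q → Δ q → b ∈ edges q → Preceq v r q)

  IsLowerCornering : Pred GPath _ → V → E → E → GPath → Set
  IsLowerCornering Δ v a b r =
    Δ r × a ∈ edges r × (∀ q → Δ q → a ∈ edges q → Preceq v q r)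

  suffixFrom : V → V → List E → List E
  suffixFrom v w es with v ≟ w
  ... | yes _ = es
  suffixFrom v w [] | no _ = []
  suffixFrom v w (e ∷ es) | no _ = suffixFrom v (tgt e) es

  -- s̄_c(Δ): the corner c = (v , a , b) followed by the common part of
  -- r↑_c(Δ) and r↓_c(Δ) after v (here taken from r↑ = r)
  sbar : V → E → E → GPath → GPath
  sbar v a b r = gpath v (suffixFrom v (start r) (edges r)) (lCorner a b) rVert

  LeftClockwise : GPath → GPath → Set
  LeftClockwise s p = InLt (start s) s p × OutLt (start s) p s

  LeftClockwiseΔ : Pred GPath _ → GPath → Set
  LeftClockwiseΔ Δ s = ∃ λ p → Δ p × LeftClockwise s p

-- The corner c = (c↓ , c↑) sits immediately below c↑ in the extended incoming order at
-- v = c•, so the generalized path s̄ entering v through c is incoming-smaller than every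
-- route entering v through c↑, in particular than r = r↑_c(Δ).  Hence (3) just says
-- r <⁺ s̄, and since s̄_c(Δ) agrees with r after v, this is (2).  For (1) ⇒ (3), let
-- p ∈ Δ with s̄ <⁻ p and p <⁺ s̄.  The letter through which p enters v is above c, so it
-- is c↑ or lies above c↑.  In the first case r ⪯ p by the choice of r; in the second
-- r <⁻ p, and coherence of r and p rules out p <⁺ r.  Either way r ≤⁺ p <⁺ s̄.
module Submission where

open import Defs
open import Data.Product using (_×_)
open import Function.Bundles using (_⇔_)
open import Relation.Binary.PropositionalEquality using (_≡_)
open import Relation.Unary using (Pred)

open import Data.Nat using (_≤_)
open import Data.Nat.Properties using (≤-refl; ≤-trans; <⇒≤; <-≤-trans; <-irrefl)
open import Data.Fin using (toℕ)
open import Data.Fin.Properties using (_≟_)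
open import Data.List using (List; []; _∷_; _++_; map; reverse; [_])
open import Data.List.Properties using (∷-injective; ++-assoc; map-++; reverse-++)
open import Data.List.Membership.Propositional using (_∈_)
open import Data.List.Membership.Propositional.Properties
  using (∈-map⁺; ∈-map⁻; ∈-∃++; ∈-++⁺ˡ; ∈-++⁺ʳ; ∈-++⁻)
open import Data.List.Relation.Unary.Any using (here; there)
open import Data.List.Relation.Unary.Any.Properties using (reverse⁻)
import Data.List.Relation.Unary.All as All
import Data.List.Relation.Unary.AllPairs as AllPairs
open import Data.List.Relation.Unary.Unique.Propositional using (Unique)
import Data.List.Relation.Unary.Unique.Propositional.Properties as Unique
open import Data.Product using (Σ; ∃; ∃₂; _,_; proj₁; proj₂)
open import Data.Sum using (_⊎_; inj₁; inj₂)
open import Data.Empty using (⊥; ⊥-elim)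
open import Function.Bundles using (mk⇔; module Equivalence)
open import Relation.Nullary using (¬_; yes; no)
open import Relation.Binary.PropositionalEquality using (refl; sym; trans; cong; subst; subst₂)

module _ {A : Set} where

  Before-∈ʳ : ∀ {x y : A} {L} → Before x y L → y ∈ L
  Before-∈ʳ (xs , ys , zs , refl) = ∈-++⁺ʳ xs (there (∈-++⁺ʳ ys (here refl)))

  Before-∷ : ∀ {x y : A} {L} w → Before x y L → Before x y (w ∷ L)
  Before-∷ w (xs , ys , zs , eq) = w ∷ xs , ys , zs , cong (w ∷_) eq

  Unique-split : ∀ (xs xs′ : List A) {x ys ys′} → Unique (xs ++ x ∷ ys) →
                 xs ++ x ∷ ys ≡ xs′ ++ x ∷ ys′ → xs ≡ xs′ × ys ≡ ys′
  Unique-split []       []        _                 eq with _ , ys≡ ← ∷-injective eq = refl , ys≡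
  Unique-split []       (y ∷ xs′) (x∉ AllPairs.∷ _) eq with refl , eq′ ← ∷-injective eq =
    ⊥-elim (All.lookup x∉ (subst (_ ∈_) (sym eq′) (∈-++⁺ʳ xs′ (here refl))) refl)
  Unique-split (y ∷ xs) []        (y∉ AllPairs.∷ _) eq with refl , _ ← ∷-injective eq =
    ⊥-elim (All.lookup y∉ (∈-++⁺ʳ xs (here refl)) refl)
  Unique-split (y ∷ xs) (_ ∷ xs′) (_ AllPairs.∷ u)  eq with refl , eq′ ← ∷-injective eq
    with xs≡ , ys≡ ← Unique-split xs xs′ u eq′ = cong (y ∷_) xs≡ , ys≡

  Before-trans : ∀ {x y z : A} {L} → Unique L → Before x y L → Before y z L → Before x z L
  Before-trans {x} {y} {z} u (A , B , C , refl) (A′ , B′ , C′ , eq)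
    with _ , refl ← Unique-split (A ++ x ∷ B) A′ (subst Unique (sym (++-assoc A (x ∷ B) (y ∷ C))) u)
                                                 (trans (++-assoc A (x ∷ B) (y ∷ C)) eq)
    = A , B ++ y ∷ B′ , C′ , cong (λ t → A ++ x ∷ t) (sym (++-assoc B (y ∷ B′) (z ∷ C′)))

  Before-consecutive : ∀ {x y z : A} {L} P Q → Unique L → L ≡ P ++ x ∷ y ∷ Q →
                       Before x z L → z ≡ y ⊎ Before y z L
  Before-consecutive P Q u eq (A , B , C , refl) with Unique-split A P u eq
  Before-consecutive P Q u eq (A , [] , C , refl) | refl , rest = inj₁ (proj₁ (∷-injective rest))
  Before-consecutive {x} P Q u eq (A , y ∷ B , C , refl) | refl , rest
    with refl , _ ← ∷-injective rest = inj₂ (A ++ [ x ] , B , C , sym (++-assoc A [ x ] _))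

  Before-total : ∀ {x y : A} {L} → x ∈ L → y ∈ L → ¬ x ≡ y → Before x y L ⊎ Before y x L
  Before-total (here refl) (here refl) x≢y = ⊥-elim (x≢y refl)
  Before-total (here refl) (there y∈) _ with B , C , refl ← ∈-∃++ y∈ = inj₁ ([] , B , C , refl)
  Before-total (there x∈) (here refl) _ with B , C , refl ← ∈-∃++ x∈ = inj₂ ([] , B , C , refl)
  Before-total {L = w ∷ _} (there x∈) (there y∈) x≢y with Before-total x∈ y∈ x≢y
  ... | inj₁ x<y = inj₁ (Before-∷ w x<y)
  ... | inj₂ y<x = inj₂ (Before-∷ w y<x)

module FramedProperties (G : FlowGraph) (F : Framing G) where
  open Framed G F

  toOut : InLetter → OutLetter
  toOut (iEdge e)     = oEdge e
  toOut (iCorner e f) = oCorner e f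
  toOut iEnd          = oEnd

  toOut-injective : ∀ {ℓ ℓ′} → toOut ℓ ≡ toOut ℓ′ → ℓ ≡ ℓ′
  toOut-injective {iEdge _}     {iEdge _}     refl = refl
  toOut-injective {iCorner _ _} {iCorner _ _} refl = refl
  toOut-injective {iEnd}        {iEnd}        refl = refl

  extOut≡map-toOut-extIn : ∀ L → extOut L ≡ map toOut (extIn L)
  extOut≡map-toOut-extIn []           = refl
  extOut≡map-toOut-extIn (e ∷ [])     = refl
  extOut≡map-toOut-extIn (e ∷ f ∷ es) =
    cong (λ t → oEdge e ∷ oCorner e f ∷ t) (extOut≡map-toOut-extIn (f ∷ es))

  Anchored : List E → InLetter → Set
  Anchored L (iEdge e)     = e ∈ L
  Anchored L (iCorner e _) = e ∈ L
  Anchored L iEnd          = ⊥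

  Anchored-∷ : ∀ {e L ℓ} → Anchored L ℓ → Anchored (e ∷ L) ℓ
  Anchored-∷ {ℓ = iEdge _}     a = there a
  Anchored-∷ {ℓ = iCorner _ _} a = there a

  extIn-anchored : ∀ L {ℓ} → ℓ ∈ extIn L → Anchored L ℓ
  extIn-anchored (e ∷ [])     (here refl)         = here refl
  extIn-anchored (e ∷ f ∷ es) (here refl)         = here refl
  extIn-anchored (e ∷ f ∷ es) (there (here refl)) = here refl
  extIn-anchored (e ∷ f ∷ es) (there (there ℓ∈))  = Anchored-∷ (extIn-anchored (f ∷ es) ℓ∈)

  extIn-unique : ∀ {L} → Unique L → Unique (extIn L)
  extIn-unique {[]}         _              = AllPairs.[]
  extIn-unique {e ∷ []}     _              = All.[] AllPairs.∷ AllPairs.[]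
  extIn-unique {e ∷ f ∷ es} (e∉ AllPairs.∷ u) =
    ((λ ()) All.∷ All.tabulate (λ { ℓ∈ refl → All.lookup e∉ (extIn-anchored (f ∷ es) ℓ∈) refl }))
    AllPairs.∷ (All.tabulate (λ { ℓ∈ refl → All.lookup e∉ (extIn-anchored (f ∷ es) ℓ∈) refl })
    AllPairs.∷ extIn-unique u)

  extOut-unique : ∀ {L} → Unique L → Unique (extOut L)
  extOut-unique {L} u rewrite extOut≡map-toOut-extIn L = Unique.map⁺ toOut-injective (extIn-unique u)

  iEdge∈extIn : ∀ {e L} → e ∈ L → iEdge e ∈ extIn L
  iEdge∈extIn {L = _ ∷ []}    (here refl) = here refl
  iEdge∈extIn {L = _ ∷ _ ∷ _} (here refl) = here refl
  iEdge∈extIn {L = _ ∷ _ ∷ _} (there e∈)  = there (there (iEdge∈extIn e∈))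

  oEdge∈extOut : ∀ {e L} → e ∈ L → oEdge e ∈ extOut L
  oEdge∈extOut {L = L} e∈ rewrite extOut≡map-toOut-extIn L = ∈-map⁺ toOut (iEdge∈extIn e∈)

  iEnd∉extIn : ∀ L → ¬ iEnd ∈ extIn L
  iEnd∉extIn L = extIn-anchored L

  oEnd∉extOut : ∀ L → ¬ oEnd ∈ extOut L
  oEnd∉extOut L oEnd∈ rewrite extOut≡map-toOut-extIn L with ∈-map⁻ toOut oEnd∈
  ... | iEnd , iEnd∈ , _ = iEnd∉extIn L iEnd∈

  extIn-∷ : ∀ e L → ∃ λ P → extIn (e ∷ L) ≡ iEdge e ∷ P ++ extIn L
  extIn-∷ e []      = [] , refl
  extIn-∷ e (f ∷ L) = [ iCorner e f ] , refl

  extIn-++ : ∀ xs L → ∃ λ P → extIn (xs ++ L) ≡ P ++ extIn L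
  extIn-++ []       L = [] , refl
  extIn-++ (x ∷ xs) L with P , eq ← extIn-∷ x (xs ++ L) | Q , eq′ ← extIn-++ xs L =
    iEdge x ∷ P ++ Q ,
    trans eq (trans (cong (λ t → iEdge x ∷ P ++ t) eq′) (cong (iEdge x ∷_) (sym (++-assoc P Q _))))

  extIn-consecutive : ∀ xs a b ys →
                      ∃₂ λ P Q → extIn (xs ++ a ∷ b ∷ ys) ≡ P ++ iCorner a b ∷ iEdge b ∷ Q
  extIn-consecutive xs a b ys with P , eq ← extIn-++ xs (a ∷ b ∷ ys) | Q , eq′ ← extIn-∷ b ys =
    P ++ [ iEdge a ] , Q ++ extIn ys ,
    trans eq (trans (cong (λ t → P ++ iEdge a ∷ iCorner a b ∷ t) eq′) (sym (++-assoc P [ iEdge a ] _)))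

  leftCorner-extIn : ∀ {v a b} → LeftCorner v a b →
    Unique (extIn (inOrd v)) × ∃₂ λ P Q → extIn (inOrd v) ≡ P ++ iCorner a b ∷ iEdge b ∷ Q
  leftCorner-extIn {v} {a} {b} (Iv , xs , ys , eq) with P , Q , eq′ ← extIn-consecutive xs a b ys =
    extIn-unique (proj₁ (inOrd-ok v Iv)) , P , Q , trans (cong extIn eq) eq′

  leftCorner-tgt : ∀ {v a b} → LeftCorner v a b → tgt b ≡ v
  leftCorner-tgt {v} {a} {b} (Iv , xs , ys , eq) =
    proj₁ (proj₂ (inOrd-ok v Iv) b) (subst (b ∈_) (sym eq) (∈-++⁺ʳ xs (there (here refl))))

  corner<in-upper : ∀ {v a b} → LeftCorner v a b → iCorner a b <in[ v ] iEdge b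
  corner<in-upper c with _ , P , Q , eq ← leftCorner-extIn c = P , [] , Q , eq

  corner<in⇒upper≤in : ∀ {v a b ℓ} → LeftCorner v a b →
                       iCorner a b <in[ v ] ℓ → ℓ ≡ iEdge b ⊎ iEdge b <in[ v ] ℓ
  corner<in⇒upper≤in c lt with u , P , Q , eq ← leftCorner-extIn c = Before-consecutive P Q u eq lt

  endV-++ : ∀ w xs ys → endV w (xs ++ ys) ≡ endV (endV w xs) ys
  endV-++ w []       ys = refl
  endV-++ w (e ∷ xs) ys = endV-++ (tgt e) xs ys

  IsPath-++⁻ˡ : ∀ w xs {ys} → IsPath w (xs ++ ys) → IsPath w xs
  IsPath-++⁻ˡ w []       _        = _
  IsPath-++⁻ˡ w (e ∷ xs) (e↦ , p) = e↦ , IsPath-++⁻ˡ (tgt e) xs p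

  IsPath-++⁻ʳ : ∀ w xs {ys} → IsPath w (xs ++ ys) → IsPath (endV w xs) ys
  IsPath-++⁻ʳ w []       p       = p
  IsPath-++⁻ʳ w (e ∷ xs) (_ , p) = IsPath-++⁻ʳ (tgt e) xs p

  path-endV-≥ : ∀ w es → IsPath w es → toℕ w ≤ toℕ (endV w es)
  path-endV-≥ w []       _        = ≤-refl
  path-endV-≥ w (e ∷ es) (refl , p) = ≤-trans (<⇒≤ (src<tgt e)) (path-endV-≥ (tgt e) es p)

  path-acyclic : ∀ w es → IsPath w es → endV w es ≡ w → es ≡ []
  path-acyclic w []       _          _    = refl
  path-acyclic w (e ∷ es) (refl , p) loop =
    ⊥-elim (<-irrefl (cong toℕ (sym loop)) (<-≤-trans (src<tgt e) (path-endV-≥ (tgt e) es p)))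

  split-post-unique : ∀ w pre₁ post₁ pre₂ post₂ → IsPath w (pre₁ ++ post₁) →
    pre₁ ++ post₁ ≡ pre₂ ++ post₂ → endV w pre₁ ≡ endV w pre₂ → post₁ ≡ post₂
  split-post-unique w []        _ []        _ _ eq _ = eq
  split-post-unique w []        _ (e ∷ pre) _ p eq at
    with () ← path-acyclic w (e ∷ pre) (IsPath-++⁻ˡ w (e ∷ pre) (subst (IsPath w) eq p)) (sym at)
  split-post-unique w (e ∷ pre) _ []        _ p eq at
    with () ← path-acyclic w (e ∷ pre) (IsPath-++⁻ˡ w (e ∷ pre) p) at
  split-post-unique w (e ∷ pre₁) post₁ (f ∷ pre₂) post₂ (_ , p) eq at
    with refl , eq′ ← ∷-injective eq = split-post-unique (tgt e) pre₁ post₁ pre₂ post₂ p eq′ at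

  afterW-unique : ∀ {p v} → IsPath (start p) (edges p) → (sp sp′ : Split p v) → afterW sp ≡ afterW sp′
  afterW-unique p-path (split pre post refl at) (split pre′ post′ eq′ at′) =
    cong (λ t → map oEdge t ++ _) (split-post-unique _ pre post pre′ post′ p-path eq′ (trans at (sym at′)))

  Split-post-path : ∀ {p v} → IsPath (start p) (edges p) → (sp : Split p v) → IsPath v (Split.post sp)
  Split-post-path p-path (split pre post refl refl) = IsPath-++⁻ʳ _ pre p-path

  Split-post-endV : ∀ {p v} (sp : Split p v) → endV v (Split.post sp) ≡ endV (start p) (edges p)
  Split-post-endV (split pre post refl refl) = sym (endV-++ _ pre post)

  beforeW-start : ∀ {p} → IsPath (start p) (edges p) → (sp : Split p (start p)) →
                  beforeW sp ≡ [ lLetter (lend p) ]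
  beforeW-start p-path (split pre post refl at)
    with refl ← path-acyclic _ pre (IsPath-++⁻ˡ _ pre p-path) at = refl

  Split-via : ∀ {p e v} → e ∈ edges p → tgt e ≡ v →
              Σ (Split p v) λ sp → ∃ λ ℓs → beforeW sp ≡ iEdge e ∷ ℓs
  Split-via {p} {e} e∈ refl with xs , ys , eq ← ∈-∃++ e∈ =
    split (xs ++ [ e ]) ys (trans eq (sym (++-assoc xs [ e ] ys))) (endV-++ (start p) xs [ e ]) ,
    reverse (map iEdge xs) ++ _ ,
    cong (_++ _) (trans (cong reverse (map-++ iEdge xs [ e ])) (reverse-++ (map iEdge xs) [ iEdge e ]))

  iEdge∈beforeW : ∀ {p v e} (sp : Split p v) → iEdge e ∈ beforeW sp → e ∈ edges p
  iEdge∈beforeW {p} (split pre post eq _) e∈ with ∈-++⁻ (reverse (map iEdge pre)) e∈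
  ... | inj₁ e∈pre with _ , e′∈ , refl ← ∈-map⁻ iEdge (reverse⁻ {xs = map iEdge pre} e∈pre) =
    subst (_ ∈_) (sym eq) (∈-++⁺ˡ {ys = post} e′∈)
  iEdge∈beforeW {gpath _ _ lVert _}         _ _ | inj₂ (here ())
  iEdge∈beforeW {gpath _ _ (lCorner _ _) _} _ _ | inj₂ (here ())

  outOrd-∋ : ∀ {w e} → Internal w → src e ≡ w → e ∈ outOrd w
  outOrd-∋ {w} {e} Iw = proj₂ (proj₂ (outOrd-ok w Iw) e)

  routeWord : List E → List OutLetter
  routeWord es = map oEdge es ++ [ oEnd ]

  -- Every comparison with a route word happens at a vertex with an incoming and an
  -- outgoing edge, where the extended outgoing order is a genuine (duplicate-free) order.
  lexOut-trans : ∀ {w X Z} es → (∃ λ e → tgt e ≡ w) → IsPath w es →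
                 LexOut w X (routeWord es) → LexOut w (routeWord es) Z → LexOut w X Z
  lexOut-trans {w} []       _   _          (here x<end) _ =
    ⊥-elim (oEnd∉extOut (outOrd w) (Before-∈ʳ x<end))
  lexOut-trans     (f ∷ _)  inc (refl , _) (here x<f) (here f<z) =
    here (Before-trans (extOut-unique (proj₁ (outOrd-ok (src f) (inc , f , refl)))) x<f f<z)
  lexOut-trans     (_ ∷ _)  _   _          (here x<f) (there _)  = here x<f
  lexOut-trans     (_ ∷ _)  _   _          (there _)  (here f<z) = here f<z
  lexOut-trans     (f ∷ es) _   (_ , p)    (there l₁) (there l₂) =
    there (lexOut-trans es (f , refl) p l₁ l₂)

  lexOut-trichotomy : ∀ {w} es fs → (∃ λ e → tgt e ≡ w) → IsPath w es → IsPath w fs →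
    IsSink (endV w es) → IsSink (endV w fs) →
    LexOut w (routeWord es) (routeWord fs) ⊎ routeWord es ≡ routeWord fs
      ⊎ LexOut w (routeWord fs) (routeWord es)
  lexOut-trichotomy []       []       _ _ _ _ _ = inj₂ (inj₁ refl)
  lexOut-trichotomy []       (f ∷ _)  _ _ (f↦ , _) sink _ = ⊥-elim (sink f f↦)
  lexOut-trichotomy (e ∷ _)  []       _ (e↦ , _) _ _ sink = ⊥-elim (sink e e↦)
  lexOut-trichotomy {w} (e ∷ es) (f ∷ fs) inc (e↦ , p) (f↦ , q) sink sink′ with e ≟ f
  ... | yes refl with lexOut-trichotomy es fs (e , refl) p q sink sink′
  ...   | inj₁ lt         = inj₁ (there lt)
  ...   | inj₂ (inj₁ eq)  = inj₂ (inj₁ (cong (oEdge e ∷_) eq))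
  ...   | inj₂ (inj₂ gt)  = inj₂ (inj₂ (there gt))
  lexOut-trichotomy {w} (e ∷ es) (f ∷ fs) inc (e↦ , p) (f↦ , q) sink sink′ | no e≢f
    with Before-total (oEdge∈extOut (outOrd-∋ (inc , e , e↦) e↦))
                      (oEdge∈extOut (outOrd-∋ (inc , e , e↦) f↦)) (λ { refl → e≢f refl })
  ... | inj₁ lt = inj₁ (here lt)
  ... | inj₂ gt = inj₂ (inj₂ (here gt))

  OutLt-trans : ∀ {v p q s} → (∃ λ e → tgt e ≡ v) → IsRoute q →
                OutLt v p q → OutLt v q s → OutLt v p s
  OutLt-trans inc ((q-path , _) , _ , refl , _) (sp , sq , p<q) (sq′ , ss , q<s) =
    sp , ss , lexOut-trans (Split.post sq′) inc (Split-post-path q-path sq′)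
                (subst (LexOut _ (afterW sp)) (afterW-unique q-path sq sq′) p<q) q<s

  OutLe-OutLt-trans : ∀ {v p q s} → (∃ λ e → tgt e ≡ v) → IsRoute q →
                      OutLe v p q → OutLt v q s → OutLt v p s
  OutLe-OutLt-trans inc q-route (inj₁ p<q) q<s = OutLt-trans inc q-route p<q q<s
  OutLe-OutLt-trans inc ((q-path , _) , _) (inj₂ (sp , sq , p=q)) (sq′ , ss , q<s) =
    sp , ss , subst (λ t → LexOut _ t (afterW ss)) (sym (trans p=q (afterW-unique q-path sq sq′))) q<s

  OutLe⊎OutGt : ∀ {v p q} → (∃ λ e → tgt e ≡ v) → IsRoute p → IsRoute q → Split p v → Split q v →
                OutLe v p q ⊎ OutLt v q p
  OutLe⊎OutGt inc ((p-path , _) , _ , refl , _ , p-sink) ((q-path , _) , _ , refl , _ , q-sink) sp sq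
    with lexOut-trichotomy (Split.post sp) (Split.post sq) inc
           (Split-post-path p-path sp) (Split-post-path q-path sq)
           (subst IsSink (sym (Split-post-endV sp)) p-sink) (subst IsSink (sym (Split-post-endV sq)) q-sink)
  ... | inj₁ p<q        = inj₁ (inj₁ (sp , sq , p<q))
  ... | inj₂ (inj₁ p=q) = inj₁ (inj₂ (sp , sq , p=q))
  ... | inj₂ (inj₂ q<p) = inj₂ (sq , sp , q<p)

  suffixFrom-split : ∀ v w pre post → IsPath w (pre ++ post) → endV w pre ≡ v →
                     suffixFrom v w (pre ++ post) ≡ post
  suffixFrom-split v w [] post _ at with v ≟ w
  ... | yes _   = refl
  ... | no v≢w = ⊥-elim (v≢w (sym at))
  suffixFrom-split v w (e ∷ pre) post p at with v ≟ w
  ... | yes refl with () ← path-acyclic v (e ∷ pre) (IsPath-++⁻ˡ v (e ∷ pre) p) at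
  ... | no _ = suffixFrom-split v (tgt e) pre post (proj₂ p) at

  sbar-afterW : ∀ {v a b r} → IsRoute r → (sr : Split r v) (sb : Split (sbar v a b r) v) →
                afterW sb ≡ afterW sr
  sbar-afterW {v} ((r-path , _) , _ , refl , _) sr@(split pre post refl at) sb =
    trans (afterW-unique sbar-path sb (split [] _ refl refl))
          (cong routeWord (suffixFrom-split v _ pre post r-path at))
    where
      sbar-path : IsPath v (suffixFrom v _ (pre ++ post))
      sbar-path = subst (IsPath v) (sym (suffixFrom-split v _ pre post r-path at))
                        (Split-post-path r-path sr)

  OutLt-sbar⇔ : ∀ {v a b r s} → IsRoute r → Split r v → OutLt v (sbar v a b r) s ⇔ OutLt v r s
  OutLt-sbar⇔ {v} {a} {b} {r} r-route sr = mk⇔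
    (λ { (sb , ss , lt) → sr , ss , subst (λ t → LexOut v t (afterW ss)) (sbar-afterW r-route sr sb) lt })
    (λ { (sr′ , ss , lt) →
           sb₀ , ss , subst (λ t → LexOut v t (afterW ss)) (sym (sbar-afterW r-route sr′ sb₀)) lt })
    where
      sb₀ : Split (sbar v a b r) v
      sb₀ = split [] _ refl refl

  LexIn-head : ∀ {v c Y} → LexIn v [ c ] Y → ∃₂ λ y ys → Y ≡ y ∷ ys × c <in[ v ] y
  LexIn-head (here c<y) = _ , _ , refl , c<y

  InLt-leftCorner-upper : ∀ {s r a b} → IsGPath s → lend s ≡ lCorner a b → b ∈ edges r →
                          InLt (start s) s r
  InLt-leftCorner-upper {gpath v _ _ _} (_ , corner , _) refl b∈r
    with sr , _ , eq ← Split-via b∈r (leftCorner-tgt corner) =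
    split [] _ refl refl , sr , subst (LexIn v _) (sym eq) (here (corner<in-upper corner))

  InLt-leftCorner⇒ : ∀ {s r p a b} → IsGPath s → lend s ≡ lCorner a b → b ∈ edges r →
                     InLt (start s) s p → b ∈ edges p ⊎ InLt (start s) r p
  InLt-leftCorner⇒ {gpath v _ _ _} {b = b} (s-path , corner , _) refl b∈r (ss , sp , s<p)
    with ℓ , _ , eq , c<ℓ ← LexIn-head (subst (λ t → LexIn v t (beforeW sp)) (beforeW-start s-path ss) s<p)
    with corner<in⇒upper≤in corner c<ℓ
  ... | inj₁ refl = inj₁ (iEdge∈beforeW sp (subst (iEdge b ∈_) (sym eq) (here refl)))
  ... | inj₂ b<ℓ with sr , _ , eq′ ← Split-via b∈r (leftCorner-tgt corner) =
    inj₂ (sr , sp , subst₂ (LexIn v) (sym eq′) (sym eq) (here b<ℓ))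

  LeftClockwiseΔ⇒OutLt : ∀ {Δ s r a b} → IsClique Δ → IsGPath s → lend s ≡ lCorner a b →
                         IsUpperCornering Δ (start s) a b r → LeftClockwiseΔ Δ s → OutLt (start s) r s
  LeftClockwiseΔ⇒OutLt {s = s} {r} (route , coherent) s-gpath@(_ , (Iv@(inc , _) , _) , _) refl
                       (r∈Δ , b∈r , r-least) (p , p∈Δ , s<⁻p , p<⁺s)
    with InLt-leftCorner⇒ s-gpath refl b∈r s<⁻p
  ... | inj₁ b∈p = OutLe-OutLt-trans inc (route p p∈Δ) (proj₂ (r-least p p∈Δ b∈p)) p<⁺s
  ... | inj₂ r<⁻p@(sr , sp , _) with OutLe⊎OutGt inc (route r r∈Δ) (route p p∈Δ) sr sp
  ...   | inj₁ r≤⁺p = OutLe-OutLt-trans inc (route p p∈Δ) r≤⁺p p<⁺s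
  ...   | inj₂ p<⁺r = ⊥-elim (proj₁ (coherent r p r∈Δ p∈Δ) (start s , Iv , r<⁻p , p<⁺r))

lemma4p5 : (G : FlowGraph) (F : Framing G) → let open Framed G F in
    (Δ : Pred GPath _) → IsMaxClique Δ →
    (s : GPath) → IsBrick s →
    (a b : E) → lend s ≡ lCorner a b →
    (r↑ r↓ : GPath) →
    IsUpperCornering Δ (start s) a b r↑ →
    IsLowerCornering Δ (start s) a b r↓ →
    (LeftClockwiseΔ Δ s ⇔ OutLt (start s) (sbar (start s) a b r↑) s)
    × (LeftClockwiseΔ Δ s ⇔ LeftClockwise s r↑)
lemma4p5 G F Δ (clique@(route , _) , _) s (s-gpath , _) a b corner r↑ _ r↑-upper@(r∈Δ , b∈r , _) _ =
  mk⇔ (λ lc → Equivalence.from sbar⇔ (lc⇒ lc)) (λ lt → r↑ , r∈Δ , s<⁻r , Equivalence.to sbar⇔ lt) ,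
  mk⇔ (λ lc → s<⁻r , lc⇒ lc) (λ lc → r↑ , r∈Δ , lc)
  where
    open Framed G F
    open FramedProperties G F

    s<⁻r : InLt (start s) s r↑
    s<⁻r = InLt-leftCorner-upper s-gpath corner b∈r

    sbar⇔ : OutLt (start s) (sbar (start s) a b r↑) s ⇔ OutLt (start s) r↑ s
    sbar⇔ = OutLt-sbar⇔ (route r↑ r∈Δ) (proj₁ (proj₂ s<⁻r))

    lc⇒ : LeftClockwiseΔ Δ s → OutLt (start s) r↑ s
    lc⇒ = LeftClockwiseΔ⇒OutLt clique s-gpath corner r↑-upper
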